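{- Let $K$ be a field of characteristic zero, let $s,t\in K$, and let $p,q\in K$ (or in an extension) be the roots of $z^2=s z+t$, assumed nonzero, distinct, with $p/q$ not a root of unity. Define $U_n=\frac{p^n-q^n}{p-q}$ and $V_n=p^n+q^n$ for $n\ge0$, and for integers $r,m\ge0$ define the $V$-mixed-$U$ binomial coefficient $$\binom{r+m}{r,m}_{\langle\cdot\rangle/\{\cdot\}}=\frac{V_{r+m}!}{V_r!\,U_m!},$$ where $V_n!=V_nV_{n-1}\cdots V_1$, $U_n!=U_nU_{n-1}\cdots U_1$, $V_0!=U_0!=1$. Then for integers $r,m\ge1$, the identity $$V_{r+m}=U_{m+1}V_r+t\,V_{r-1}U_m$$ is equivalent to $$\binom{r+m}{r,m}_{\langle\cdot\rangle/\{\cdot\}}=U_{m+1}\binom{r+m-1}{r-1,m}_{\langle\cdot\rangle/\{\cdot\}}+t\,V_{r-1}\binom{r+m-1}{r,m-1}_{\langle\cdot\rangle/\{\cdot\}}.$$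
   Context: $U$ and $V$ are the Lucas sequences of the first and second kind associated with $z^2=sz+t$ (so $p+q=s$, $pq=-t$, $U_0=0$, $U_1=1$, $V_0=2$, $V_1=s$). The letter $m$ replaces the paper's second index $s$ to avoid clash with the coefficient $s$. -}

module Defs where

open import Level using (Level; suc; _⊔_)
open import Data.Nat.Base as ℕ using (ℕ; zero) renaming (suc to 1+)
open import Relation.Nullary using (¬_)
open import Algebra.Bundles using (CommutativeRing; Semiring)
import Algebra.Definitions.RawSemiring as RawSemiringDefs

-- A field: a commutative ring with 0 ≠ 1 and a (total) inverse map
-- that is a genuine inverse on every nonzero element
-- (the value at 0 is irrelevant).  The stdlib has no `Field` bundle.
record Field (c ℓ : Level) : Set (suc (c ⊔ ℓ)) where
  field
    commutativeRing : CommutativeRing c ℓ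
  open CommutativeRing commutativeRing public
  infix 8 _⁻¹
  field
    _⁻¹      : Carrier → Carrier
    0≉1      : ¬ (0# ≈ 1#)
    inverseʳ : ∀ x → ¬ (x ≈ 0#) → x * (x ⁻¹) ≈ 1#
  open RawSemiringDefs (Semiring.rawSemiring semiring) public using (_×_; _^_)

  infixl 7 _/_
  _/_ : Carrier → Carrier → Carrier
  x / y = x * (y ⁻¹)

module _ {c ℓ} (K : Field c ℓ) where
  open Field K

  CharZero : Set ℓ
  CharZero = ∀ (n : ℕ) → ¬ ((1+ n) × 1# ≈ 0#)

  module Lucas (s t : Carrier) where
    U : ℕ → Carrier
    U 0 = 0#
    U 1 = 1#
    U (1+ (1+ n)) = s * U (1+ n) + t * U n

    V : ℕ → Carrier
    V 0 = 1# + 1#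
    V 1 = s
    V (1+ (1+ n)) = s * V (1+ n) + t * V n

    U! : ℕ → Carrier
    U! 0 = 1#
    U! (1+ n) = U (1+ n) * U! n

    V! : ℕ → Carrier
    V! 0 = 1#
    V! (1+ n) = V (1+ n) * V! n

    VUbinom : ℕ → ℕ → Carrier
    VUbinom r m = V! (r ℕ.+ m) / (V! r * U! m)

module Submission where

open import Defs
open import Data.Nat.Base as ℕ using (ℕ) renaming (suc to 1+)
open import Data.Nat.Properties using (+-suc)
open import Relation.Nullary using (¬_)
open import Relation.Binary.PropositionalEquality using (cong) renaming (sym to sym≡)
open import Function.Bundles using (_⇔_; mk⇔)
open import Function.Construct.Composition using (_⇔-∘_)
import Algebra.Properties.Ring as RingProperties
import Algebra.Properties.Group as GroupProperties
import Algebra.Properties.CommutativeSemigroup as CommutativeSemigroupProperties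
import Algebra.Properties.CommutativeSemiring.Exp as ExpProperties
import Algebra.Solver.Ring.NaturalCoefficients.Default as Solver
import Relation.Binary.Reasoning.Setoid as SetoidReasoning

-- Write X = V_{r+m+1}!,  D = V_{r+1}! U_{m+1}!  and  k = X / D.
-- Then the three binomials occurring in the recurrence are
--     ⟨r+m+2 ; r+1,m+1⟩ = V_{r+m+2} k,
--     ⟨r+m+1 ; r,m+1⟩   = V_{r+1} k,
--     ⟨r+m+1 ; r+1,m⟩   = U_{m+1} k,
-- so the binomial recurrence is the Lucas identity multiplied by k, and the
-- two are equivalent as soon as k ≠ 0, i.e. as soon as no V_n, U_n (n ≥ 1)
-- vanishes.  That non-vanishing is where the hypotheses on p, q enter:
-- the Binet forms  U_{n+1} = q U_n + p^n  (and symmetrically with p, q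
-- swapped) and  V_n = p^n + q^n  show that U_{n+1} = 0 or V_{n+1} = 0 would
-- force p^k = q^k for some k ≥ 1, i.e. (p/q)^k = 1.
-- The file proves, in order: elementary field facts, the Binet forms, the
-- non-vanishing of the Lucas factorials, the factorisation of the binomials,
-- and finally the theorem.

module _ {c ℓ} (K : Field c ℓ) where
  open Field K
  open RingProperties ring using (-‿distribˡ-*; -‿distribʳ-*)
  open GroupProperties +-group using (inverseʳ-unique; x≈z//y; ⁻¹-involutive)
  open CommutativeSemigroupProperties *-commutativeSemigroup using (xy∙z≈y∙xz; x∙yz≈y∙xz)
  open ExpProperties commutativeSemiring using (^-distrib-*; ^-congˡ; ^-homo-*)
  open Solver commutativeSemiring using (solve; _:+_; _:*_; _:=_)
  open SetoidReasoning setoid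

  *-nonzero : ∀ {x y} → ¬ (x ≈ 0#) → ¬ (y ≈ 0#) → ¬ (x * y ≈ 0#)
  *-nonzero {x} {y} x≉0 y≉0 xy≈0 = y≉0 (begin
    y                  ≈⟨ sym (*-identityˡ y) ⟩
    1# * y             ≈⟨ *-congʳ (sym (trans (*-comm _ _) (inverseʳ x x≉0))) ⟩
    (x ⁻¹ * x) * y     ≈⟨ *-assoc _ _ _ ⟩
    x ⁻¹ * (x * y)     ≈⟨ *-congˡ xy≈0 ⟩
    x ⁻¹ * 0#          ≈⟨ zeroʳ _ ⟩
    0#                 ∎)

  ⁻¹-nonzero : ∀ {x} → ¬ (x ≈ 0#) → ¬ (x ⁻¹ ≈ 0#)
  ⁻¹-nonzero {x} x≉0 x⁻¹≈0 =
    0≉1 (trans (sym (zeroʳ x)) (trans (*-congˡ (sym x⁻¹≈0)) (inverseʳ x x≉0)))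

  /-*-cancel : ∀ {d} → ¬ (d ≈ 0#) → ∀ x → x / d * d ≈ x
  /-*-cancel {d} d≉0 x = begin
    x * d ⁻¹ * d       ≈⟨ *-assoc _ _ _ ⟩
    x * (d ⁻¹ * d)     ≈⟨ *-congˡ (trans (*-comm _ _) (inverseʳ d d≉0)) ⟩
    x * 1#             ≈⟨ *-identityʳ x ⟩
    x                  ∎

  /-unique : ∀ {d x z} → ¬ (d ≈ 0#) → z * d ≈ x → z ≈ x / d
  /-unique {d} {x} {z} d≉0 zd≈x = begin
    z                  ≈⟨ sym (*-identityʳ z) ⟩
    z * 1#             ≈⟨ *-congˡ (sym (inverseʳ d d≉0)) ⟩
    z * (d * d ⁻¹)     ≈⟨ sym (*-assoc _ _ _) ⟩
    z * d * d ⁻¹       ≈⟨ *-congʳ zd≈x ⟩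
    x / d              ∎

  /-scale : ∀ {c d e} x → ¬ (d ≈ 0#) → ¬ (e ≈ 0#) → c * d ≈ e → x / d ≈ c * (x / e)
  /-scale {c} {d} {e} x d≉0 e≉0 cd≈e = sym (/-unique d≉0 (begin
    c * (x / e) * d    ≈⟨ xy∙z≈y∙xz c (x / e) d ⟩
    x / e * (c * d)    ≈⟨ *-congˡ cd≈e ⟩
    x / e * e          ≈⟨ /-*-cancel e≉0 x ⟩
    x                  ∎))

  *-cancelʳ-⇔ : ∀ {k} A B → ¬ (k ≈ 0#) → (A ≈ B) ⇔ (A * k ≈ B * k)
  *-cancelʳ-⇔ A B k≉0 = mk⇔ *-congʳ λ Ak≈Bk → begin
    A                  ≈⟨ /-unique k≉0 refl ⟩
    A * _ / _          ≈⟨ *-congʳ Ak≈Bk ⟩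
    B * _ / _          ≈⟨ sym (/-unique k≉0 refl) ⟩
    B                  ∎

  ≈-resp-⇔ : ∀ {x x′ y y′} → x ≈ x′ → y ≈ y′ → (x ≈ y) ⇔ (x′ ≈ y′)
  ≈-resp-⇔ x≈x′ y≈y′ =
    mk⇔ (λ x≈y → trans (sym x≈x′) (trans x≈y y≈y′))
        (λ x′≈y′ → trans x≈x′ (trans x′≈y′ (sym y≈y′)))

  opposite-squares : ∀ {x y} → x ≈ - y → x * x ≈ y * y
  opposite-squares {x} {y} x≈-y = begin
    x * x              ≈⟨ *-cong x≈-y x≈-y ⟩
    - y * - y          ≈⟨ sym (-‿distribˡ-* y (- y)) ⟩
    - (y * - y)        ≈⟨ -‿cong (sym (-‿distribʳ-* y y)) ⟩
    - - (y * y)        ≈⟨ ⁻¹-involutive _ ⟩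
    y * y              ∎

  1^n≈1 : ∀ n → 1# ^ n ≈ 1#
  1^n≈1 ℕ.zero   = refl
  1^n≈1 (1+ n) = trans (*-identityˡ _) (1^n≈1 n)

  power-ratio : ∀ {p q} n → ¬ (q ≈ 0#) → p ^ n ≈ q ^ n → (p / q) ^ n ≈ 1#
  power-ratio {p} {q} n q≉0 pⁿ≈qⁿ = begin
    (p * q ⁻¹) ^ n     ≈⟨ ^-distrib-* p (q ⁻¹) n ⟩
    p ^ n * (q ⁻¹) ^ n ≈⟨ *-congʳ pⁿ≈qⁿ ⟩
    q ^ n * (q ⁻¹) ^ n ≈⟨ sym (^-distrib-* q (q ⁻¹) n) ⟩
    (q * q ⁻¹) ^ n     ≈⟨ ^-congˡ n (inverseʳ q q≉0) ⟩
    1# ^ n             ≈⟨ 1^n≈1 n ⟩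
    1#                 ∎

  module Root (s t a b : Carrier) (a+b≈s : a + b ≈ s) (ab≈-t : a * b ≈ - t) where
    open Lucas K s t

    t*y≈a*-by : ∀ y → t * y ≈ a * - (b * y)
    t*y≈a*-by y = begin
      t * y              ≈⟨ *-congʳ t≈-ab ⟩
      - (a * b) * y      ≈⟨ sym (-‿distribˡ-* _ y) ⟩
      - (a * b * y)      ≈⟨ -‿cong (*-assoc a b y) ⟩
      - (a * (b * y))    ≈⟨ -‿distribʳ-* a _ ⟩
      a * - (b * y)      ∎
      where
      t≈-ab : t ≈ - (a * b)
      t≈-ab = inverseʳ-unique (a * b) t (trans (+-congʳ ab≈-t) (-‿inverseˡ t))

    -- One step of the recurrence, split along the factorisation
    -- z² − s z − t = (z − a)(z − b).
    recurrence-split : ∀ x y → s * x + t * y ≈ b * x + a * (x + - (b * y))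
    recurrence-split x y = begin
      s * x + t * y                ≈⟨ +-cong (*-congʳ (sym a+b≈s)) (t*y≈a*-by y) ⟩
      (a + b) * x + a * - (b * y)  ≈⟨ solve 4 (λ a b x n → (a :+ b) :* x :+ a :* n
                                                 := b :* x :+ a :* (x :+ n))
                                               refl a b x (- (b * y)) ⟩
      b * x + a * (x + - (b * y))  ∎

    power-recurrence : ∀ n → a ^ (1+ (1+ n)) ≈ s * a ^ (1+ n) + t * a ^ n
    power-recurrence n = sym (begin
      s * (a * aⁿ) + t * aⁿ                ≈⟨ +-cong (*-congʳ (sym a+b≈s)) (t*y≈a*-by aⁿ) ⟩
      (a + b) * (a * aⁿ) + a * - (b * aⁿ)  ≈⟨ solve 4 (λ a b x n → (a :+ b) :* (a :* x) :+ a :* n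
                                                         := a :* (a :* x) :+ a :* (b :* x :+ n))
                                                       refl a b aⁿ (- (b * aⁿ)) ⟩
      a * (a * aⁿ) + a * (b * aⁿ + - (b * aⁿ)) ≈⟨ +-congˡ (trans (*-congˡ (-‿inverseʳ _)) (zeroʳ a)) ⟩
      a * (a * aⁿ) + 0#                    ≈⟨ +-identityʳ _ ⟩
      a * (a * aⁿ)                         ∎)
      where
      aⁿ : Carrier
      aⁿ = a ^ n

    U-binet : ∀ n → U (1+ n) ≈ b * U n + a ^ n
    U-binet ℕ.zero   = sym (trans (+-congʳ (zeroʳ b)) (+-identityˡ 1#))
    U-binet (1+ n) = begin
      s * U (1+ n) + t * U n                   ≈⟨ recurrence-split (U (1+ n)) (U n) ⟩
      b * U (1+ n) + a * (U (1+ n) + - (b * U n)) ≈⟨ +-congˡ (*-congˡ (sym aⁿ≈diff)) ⟩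
      b * U (1+ n) + a * a ^ n                 ∎
      where
      aⁿ≈diff : a ^ n ≈ U (1+ n) + - (b * U n)
      aⁿ≈diff = x≈z//y (a ^ n) (b * U n) (U (1+ n)) (trans (+-comm _ _) (sym (U-binet n)))

  V-binet : ∀ s t p q → p + q ≈ s → p * q ≈ - t → ∀ n → Lucas.V K s t n ≈ p ^ n + q ^ n
  V-binet s t p q p+q≈s pq≈-t = go
    where
    open Lucas K s t
    q+p≈s : q + p ≈ s
    q+p≈s = trans (+-comm q p) p+q≈s
    qp≈-t : q * p ≈ - t
    qp≈-t = trans (*-comm q p) pq≈-t
    go : ∀ n → V n ≈ p ^ n + q ^ n
    go ℕ.zero          = refl
    go (1+ ℕ.zero)     = trans (sym p+q≈s) (sym (+-cong (*-identityʳ p) (*-identityʳ q)))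
    go (1+ (1+ n)) = begin
      s * V (1+ n) + t * V n
        ≈⟨ +-cong (*-congˡ (go (1+ n))) (*-congˡ (go n)) ⟩
      s * (p ^ (1+ n) + q ^ (1+ n)) + t * (p ^ n + q ^ n)
        ≈⟨ solve 6 (λ s t x y u v → s :* (x :+ y) :+ t :* (u :+ v)
                                    := (s :* x :+ t :* u) :+ (s :* y :+ t :* v))
                   refl s t (p ^ (1+ n)) (q ^ (1+ n)) (p ^ n) (q ^ n) ⟩
      (s * p ^ (1+ n) + t * p ^ n) + (s * q ^ (1+ n) + t * q ^ n)
        ≈⟨ +-cong (sym (Root.power-recurrence s t p q p+q≈s pq≈-t n))
                  (sym (Root.power-recurrence s t q p q+p≈s qp≈-t n)) ⟩
      p ^ (1+ (1+ n)) + q ^ (1+ (1+ n)) ∎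

  module NonDegenerate (s t p q : Carrier) (p+q≈s : p + q ≈ s) (pq≈-t : p * q ≈ - t)
                       (q≉0 : ¬ (q ≈ 0#))
                       (no-root-of-unity : ∀ n → ¬ ((p / q) ^ (1+ n) ≈ 1#)) where
    open Lucas K s t

    distinct-powers : ∀ n → ¬ (p ^ (1+ n) ≈ q ^ (1+ n))
    distinct-powers n pᵏ≈qᵏ = no-root-of-unity n (power-ratio (1+ n) q≉0 pᵏ≈qᵏ)

    drop-zero : ∀ {x} c y → x ≈ 0# → c * x + y ≈ y
    drop-zero c y x≈0 = trans (+-congʳ (trans (*-congˡ x≈0) (zeroʳ c))) (+-identityˡ y)

    -- U_{n+2} = q U_{n+1} + p^{n+1} = p U_{n+1} + q^{n+1}.
    U-nonzero : ∀ n → ¬ (U (1+ n) ≈ 0#)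
    U-nonzero n Uₙ₊₁≈0 = distinct-powers n (begin
      p ^ (1+ n)                   ≈⟨ sym (drop-zero q _ Uₙ₊₁≈0) ⟩
      q * U (1+ n) + p ^ (1+ n)    ≈⟨ sym (Root.U-binet s t p q p+q≈s pq≈-t (1+ n)) ⟩
      U (1+ (1+ n))                ≈⟨ Root.U-binet s t q p (trans (+-comm q p) p+q≈s)
                                                        (trans (*-comm q p) pq≈-t) (1+ n) ⟩
      p * U (1+ n) + q ^ (1+ n)    ≈⟨ drop-zero p _ Uₙ₊₁≈0 ⟩
      q ^ (1+ n)                   ∎)

    -- V_{n+1} = 0 means p^{n+1} = −q^{n+1}, so p^{2n+2} = q^{2n+2}.
    V-nonzero : ∀ n → ¬ (V (1+ n) ≈ 0#)
    V-nonzero n Vₙ₊₁≈0 = distinct-powers (n ℕ.+ 1+ n) (begin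
      p ^ (1+ n ℕ.+ 1+ n)          ≈⟨ ^-homo-* p (1+ n) (1+ n) ⟩
      p ^ (1+ n) * p ^ (1+ n)      ≈⟨ opposite-squares pᵏ≈-qᵏ ⟩
      q ^ (1+ n) * q ^ (1+ n)      ≈⟨ sym (^-homo-* q (1+ n) (1+ n)) ⟩
      q ^ (1+ n ℕ.+ 1+ n)          ∎)
      where
      pᵏ≈-qᵏ : p ^ (1+ n) ≈ - q ^ (1+ n)
      pᵏ≈-qᵏ = inverseʳ-unique _ _
        (trans (+-comm _ _) (trans (sym (V-binet s t p q p+q≈s pq≈-t (1+ n))) Vₙ₊₁≈0))

    V!-nonzero : ∀ n → ¬ (V! n ≈ 0#)
    V!-nonzero ℕ.zero   = λ 1≈0 → 0≉1 (sym 1≈0)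
    V!-nonzero (1+ n) = *-nonzero (V-nonzero n) (V!-nonzero n)

    U!-nonzero : ∀ n → ¬ (U! n ≈ 0#)
    U!-nonzero ℕ.zero   = λ 1≈0 → 0≉1 (sym 1≈0)
    U!-nonzero (1+ n) = *-nonzero (U-nonzero n) (U!-nonzero n)

  module Binomials (s t : Carrier) (V!≉0 : ∀ n → ¬ (Lucas.V! K s t n ≈ 0#))
                   (U!≉0 : ∀ n → ¬ (Lucas.U! K s t n ≈ 0#)) where
    open Lucas K s t

    common : ℕ → ℕ → Carrier
    common r m = V! (r ℕ.+ 1+ m) / (V! (1+ r) * U! (1+ m))

    common-nonzero : ∀ r m → ¬ (common r m ≈ 0#)
    common-nonzero r m =
      *-nonzero (V!≉0 (r ℕ.+ 1+ m)) (⁻¹-nonzero (*-nonzero (V!≉0 (1+ r)) (U!≉0 (1+ m))))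

    binom-top : ∀ r m → VUbinom (1+ r) (1+ m) ≈ V (1+ r ℕ.+ 1+ m) * common r m
    binom-top r m = *-assoc _ _ _

    binom-left : ∀ r m → VUbinom r (1+ m) ≈ V (1+ r) * common r m
    binom-left r m =
      /-scale (V! (r ℕ.+ 1+ m)) (*-nonzero (V!≉0 r) (U!≉0 (1+ m)))
              (*-nonzero (V!≉0 (1+ r)) (U!≉0 (1+ m))) (sym (*-assoc _ _ _))

    binom-right : ∀ r m → VUbinom (1+ r) m ≈ U (1+ m) * common r m
    binom-right r m = begin
      V! (1+ r ℕ.+ m) / (V! (1+ r) * U! m)    ≈⟨ *-congʳ (reflexive (cong V! (sym≡ (+-suc r m)))) ⟩
      V! (r ℕ.+ 1+ m) / (V! (1+ r) * U! m)    ≈⟨ /-scale _ (*-nonzero (V!≉0 (1+ r)) (U!≉0 m))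
                                                       (*-nonzero (V!≉0 (1+ r)) (U!≉0 (1+ m)))
                                                       (x∙yz≈y∙xz _ _ _) ⟩
      U (1+ m) * common r m                   ∎

    -- The binomial recurrence is the Lucas identity multiplied by k.
    recurrence⇔ : ∀ r m →
      (V (1+ r ℕ.+ 1+ m) ≈ U (1+ (1+ m)) * V (1+ r) + t * V r * U (1+ m))
      ⇔
      (VUbinom (1+ r) (1+ m) ≈ U (1+ (1+ m)) * VUbinom r (1+ m) + t * V r * VUbinom (1+ r) m)
    recurrence⇔ r m =
      ≈-resp-⇔ (sym (binom-top r m)) rhs-factor ⇔-∘ *-cancelʳ-⇔ _ _ (common-nonzero r m)
      where
      k : Carrier
      k = common r m
      rhs-factor : (U (1+ (1+ m)) * V (1+ r) + t * V r * U (1+ m)) * k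
                   ≈ U (1+ (1+ m)) * VUbinom r (1+ m) + t * V r * VUbinom (1+ r) m
      rhs-factor = begin
        (U (1+ (1+ m)) * V (1+ r) + t * V r * U (1+ m)) * k
          ≈⟨ solve 5 (λ u v w x k → (u :* v :+ w :* x) :* k := u :* (v :* k) :+ w :* (x :* k))
                     refl (U (1+ (1+ m))) (V (1+ r)) (t * V r) (U (1+ m)) k ⟩
        U (1+ (1+ m)) * (V (1+ r) * k) + t * V r * (U (1+ m) * k)
          ≈⟨ sym (+-cong (*-congˡ (binom-left r m)) (*-congˡ (binom-right r m))) ⟩
        U (1+ (1+ m)) * VUbinom r (1+ m) + t * V r * VUbinom (1+ r) m ∎

mainTheorem3 : ∀ {c ℓ} (K : Field c ℓ) → CharZero K →
    let open Field K in
    let open Lucas K in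
    (s t p q : Carrier) →
    p + q ≈ s → p * q ≈ - t →
    ¬ (p ≈ 0#) → ¬ (q ≈ 0#) → ¬ (p ≈ q) →
    (∀ (n : ℕ) → ¬ ((p / q) ^ (1+ n) ≈ 1#)) →
    (r m : ℕ) →
    (V s t (1+ r ℕ.+ 1+ m) ≈ U s t (1+ (1+ m)) * V s t (1+ r) + t * V s t r * U s t (1+ m))
    ⇔
    (VUbinom s t (1+ r) (1+ m) ≈ U s t (1+ (1+ m)) * VUbinom s t r (1+ m) + t * V s t r * VUbinom s t (1+ r) m)
mainTheorem3 K _ s t p q p+q≈s pq≈-t _ q≉0 _ no-root-of-unity =
  Binomials.recurrence⇔ K s t (NonDegenerate.V!-nonzero K s t p q p+q≈s pq≈-t q≉0 no-root-of-unity)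
                              (NonDegenerate.U!-nonzero K s t p q p+q≈s pq≈-t q≉0 no-root-of-unity)
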